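{- Let $(\mathcal{I},\mathcal{T},\mathcal{B})$ be a regular model checking problem over a finite alphabet $\Sigma$, and run the learning-based procedure described in the context, with the learner being any automata learning algorithm that poses membership and equivalence queries. If the procedure terminates, then its answer is correct: if it halts with output "true" (together with a finite automaton $\mathcal{A}_h$), then $T^*(I)\cap B=\emptyset$, and if it halts with output "false" (together with a word $w$), then $T^*(I)\cap B\neq\emptyset$.
   Context: A regular model checking (RMC) problem is a triple $(\mathcal{I},\mathcal{T},\mathcal{B})$ where $\mathcal{I}$ and $\mathcal{B}$ are finite automata over a finite alphabet $\Sigma$ recognising regular languages $I,B\subseteq\Sigma^*$ (initial and bad configurations), and $\mathcal{T}$ is a length-preserving finite transducer (every transition reads one letter and writes one letter of $\Sigma$) recognising a relation $T\subseteq\Sigma^*\times\Sigma^*$ with $|x|=|y|$ for all $(x,y)\in T$. For $X\subseteq\Sigma^*$, $T(X)=\{y\mid \exists x\in X, (x,y)\in T\}$, and $T^*(I)$ denotes the set of words reachable from $I$ by zero or more applications of $T$. The problem asks whether $T^*(I)\cap B=\emptyset$. The procedure consists of a learner (an automata learning algorithm) interacting with a teacher. Membership query on $w\in\Sigma^*$: the teacher answers yes iff $w\in T^*(I)$ (decidable since $T$ is length-preserving). Equivalence query on a candidate finite automaton $\mathcal{A}_h$ with language $A_h$: (1) if $I\not\subseteq A_h$, the teacher picks $w\in I\setminus A_h$ and returns it to the learner as a counterexample; (2) else if $A_h\cap B\neq\emptyset$, the teacher picks $w\in A_h\cap B$; if $w\in T^*(I)$ the procedure halts with output "false" and $w$,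 otherwise $w$ is returned to the learner as a counterexample; (3) else if $T(A_h)\not\subseteq A_h$, the teacher picks $(w,w')\in T$ with $w\in A_h$, $w'\notin A_h$; if $w\in T^*(I)$ it returns $w'$ as a counterexample, otherwise it returns $w$ as a counterexample; (4) otherwise the procedure halts with output "true" and $\mathcal{A}_h$ (an inductive invariant). -}

module Defs where

open import Data.Nat using (ℕ)
open import Data.Fin using (Fin)
open import Data.Bool using (Bool; true; false)
open import Data.List using (List; []; _∷_)
open import Data.Product using (Σ; ∃; _×_; _,_)
open import Data.Sum using (_⊎_)
open import Data.Empty using (⊥)
open import Relation.Nullary using (¬_)
open import Relation.Binary.PropositionalEquality using (_≡_)

Lang : Set → Set₁
Lang A = List A → Set

record NFA (A : Set) : Set where
  field
    nQ    : ℕ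
    init  : Fin nQ → Bool
    final : Fin nQ → Bool
    δ     : Fin nQ → A → Fin nQ → Bool

module _ {A : Set} (M : NFA A) where
  open NFA M
  data AcceptsFrom : Fin nQ → List A → Set where
    done : ∀ {q} → final q ≡ true → AcceptsFrom q []
    step : ∀ {q a q' w} → δ q a q' ≡ true → AcceptsFrom q' w → AcceptsFrom q (a ∷ w)

L⟦_⟧ : {A : Set} → NFA A → Lang A
L⟦ M ⟧ w = Σ (Fin (NFA.nQ M)) λ q → (NFA.init M q ≡ true) × AcceptsFrom M q w

record Transducer (A : Set) : Set where
  field
    nQ    : ℕ
    init  : Fin nQ → Bool
    final : Fin nQ → Bool
    δ     : Fin nQ → A → A → Fin nQ → Bool

module _ {A : Set} (M : Transducer A) where
  open Transducer M
  data TAcceptsFrom : Fin nQ → List A → List A → Set where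
    done : ∀ {q} → final q ≡ true → TAcceptsFrom q [] []
    step : ∀ {q a b q' x y} → δ q a b q' ≡ true → TAcceptsFrom q' x y →
           TAcceptsFrom q (a ∷ x) (b ∷ y)

R⟦_⟧ : {A : Set} → Transducer A → List A → List A → Set
R⟦ M ⟧ x y = Σ (Fin (Transducer.nQ M)) λ q →
  (Transducer.init M q ≡ true) × TAcceptsFrom M q x y

record RMC (k : ℕ) : Set where
  field
    𝓘 : NFA (Fin k)
    𝓣 : Transducer (Fin k)
    𝓑 : NFA (Fin k)

module _ {k : ℕ} (P : RMC k) where
  open RMC P

  I B : Lang (Fin k)
  I = L⟦ 𝓘 ⟧
  B = L⟦ 𝓑 ⟧

  T : List (Fin k) → List (Fin k) → Set
  T = R⟦ 𝓣 ⟧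

  data Reach : List (Fin k) → Set where
    base : ∀ {w} → I w → Reach w
    next : ∀ {w w'} → Reach w → T w w' → Reach w'

  Safe : Set
  Safe = ∀ w → Reach w → B w → ⊥

-- The learner: an arbitrary automata learning algorithm, modelled as a
-- (possibly infinite-state) machine that in each state poses either a
-- membership query or an equivalence query, and updates its state
-- with the teacher's answer (yes/no, or a counterexample word).

data Query (k : ℕ) : Set where
  mem   : List (Fin k) → Query k
  equiv : NFA (Fin k) → Query k

record Learner (k : ℕ) : Set₁ where
  field
    State   : Set
    start   : State
    query   : State → Query k
    onMem   : State → Bool → State
    onCE    : State → List (Fin k) → State

data Output (k : ℕ) : Set where
  outTrue  : NFA (Fin k) → Output k
  outFalse : List (Fin k) → Output k

module Teacher {k : ℕ} (P : RMC k) where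
  open RMC P

  Iₚ Bₚ : Lang (Fin k)
  Iₚ = I P
  Bₚ = B P

  MemAnswer : List (Fin k) → Bool → Set
  MemAnswer w b = (b ≡ true → Reach P w) × (Reach P w → b ≡ true)

  -- The teacher may return counterexample w to the equivalence query
  -- on hypothesis 𝓐 (cases (1)-(3) of the procedure; the teacher's
  -- choice of witness is arbitrary).
  data CE (𝓐 : NFA (Fin k)) (w : List (Fin k)) : Set where
    case1 : Iₚ w → ¬ L⟦ 𝓐 ⟧ w → CE 𝓐 w
    case2 : (∀ v → Iₚ v → L⟦ 𝓐 ⟧ v) →
            L⟦ 𝓐 ⟧ w → Bₚ w → ¬ Reach P w → CE 𝓐 w
    case3-reach : (∀ v → Iₚ v → L⟦ 𝓐 ⟧ v) →
            (∀ v → L⟦ 𝓐 ⟧ v → Bₚ v → ⊥) →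
            ∀ v → T P v w → L⟦ 𝓐 ⟧ v → ¬ L⟦ 𝓐 ⟧ w → Reach P v → CE 𝓐 w
    case3-unreach : (∀ v → Iₚ v → L⟦ 𝓐 ⟧ v) →
            (∀ v → L⟦ 𝓐 ⟧ v → Bₚ v → ⊥) →
            ∀ v' → T P w v' → L⟦ 𝓐 ⟧ w → ¬ L⟦ 𝓐 ⟧ v' → ¬ Reach P w → CE 𝓐 w

  module _ (𝓛 : Learner k) where
    open Learner 𝓛
    data Halts : State → Output k → Set where
      memQ : ∀ {s o w} → query s ≡ mem w → (b : Bool) → MemAnswer w b →
             Halts (onMem s b) o → Halts s o
      ceQ  : ∀ {s o 𝓐} → query s ≡ equiv 𝓐 → (w : List (Fin k)) → CE 𝓐 w →
             Halts (onCE s w) o → Halts s o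
      -- case (2), halting with "false" and w
      haltFalse : ∀ {s 𝓐} → query s ≡ equiv 𝓐 → (w : List (Fin k)) →
             (∀ v → Iₚ v → L⟦ 𝓐 ⟧ v) →
             L⟦ 𝓐 ⟧ w → Bₚ w → Reach P w → Halts s (outFalse w)
      -- case (4), halting with "true" and 𝓐
      haltTrue : ∀ {s 𝓐} → query s ≡ equiv 𝓐 →
             (∀ v → Iₚ v → L⟦ 𝓐 ⟧ v) →
             (∀ v → L⟦ 𝓐 ⟧ v → Bₚ v → ⊥) →
             (∀ v v' → L⟦ 𝓐 ⟧ v → T P v v' → L⟦ 𝓐 ⟧ v') →
             Halts s (outTrue 𝓐)

-- Halting with "true" requires a hypothesis containing I, disjoint from B
-- and closed under T; such an inductive invariant contains all of T*(I),
-- which is therefore disjoint from B. Halting with "false" happens only on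
-- a word the teacher has verified to lie in T*(I) ∩ B. Membership queries
-- and counterexamples merely change the learner's state, so induction on
-- the run reduces both claims to these two halting steps.
module Submission where

open import Defs
open import Data.Nat using (ℕ)
open import Data.Fin using (Fin)
open import Data.List using (List)
open import Data.Product using (∃; _×_; _,_)

module _ {k : ℕ} (P : RMC k) where

  reach⊆inductiveInvariant : (A : Lang (Fin k)) →
    (∀ v → I P v → A v) → (∀ v v' → A v → T P v v' → A v') →
    ∀ {w} → Reach P w → A w
  reach⊆inductiveInvariant A I⊆A T-closed (base i) = I⊆A _ i
  reach⊆inductiveInvariant A I⊆A T-closed (next r t) =
    T-closed _ _ (reach⊆inductiveInvariant A I⊆A T-closed r) t

  module _ (𝓛 : Learner k) where
    open Teacher P

    halts-true⇒safe : ∀ {s 𝓐} → Halts 𝓛 s (outTrue 𝓐) → Safe P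
    halts-true⇒safe (memQ _ _ _ run) = halts-true⇒safe run
    halts-true⇒safe (ceQ _ _ _ run) = halts-true⇒safe run
    halts-true⇒safe (haltTrue {𝓐 = 𝓐} _ I⊆A A∩B=∅ T-closed) w r =
      A∩B=∅ w (reach⊆inductiveInvariant L⟦ 𝓐 ⟧ I⊆A T-closed r)

    halts-false⇒unsafe : ∀ {s w} → Halts 𝓛 s (outFalse w) →
      ∃ λ u → Reach P u × B P u
    halts-false⇒unsafe (memQ _ _ _ run) = halts-false⇒unsafe run
    halts-false⇒unsafe (ceQ _ _ _ run) = halts-false⇒unsafe run
    halts-false⇒unsafe (haltFalse _ w _ _ w∈B w∈T*I) = w , w∈T*I , w∈B

mainTheorem1 : ∀ {k : ℕ} (P : RMC k) (𝓛 : Learner k) →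
    (∀ (𝓐 : NFA (Fin k)) → Teacher.Halts P 𝓛 (Learner.start 𝓛) (outTrue 𝓐) →
       Safe P)
    × (∀ (w : List (Fin k)) → Teacher.Halts P 𝓛 (Learner.start 𝓛) (outFalse w) →
       ∃ λ (u : List (Fin k)) → Reach P u × B P u)
mainTheorem1 P 𝓛 =
  (λ _ → halts-true⇒safe P 𝓛) , (λ _ → halts-false⇒unsafe P 𝓛)
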